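{- Let $n\ge 2$ be an integer and let $A\in\Delta_n^2$. Then there is an integer $p$ with $2\le p\le n$ such that $A$ is block diagonal of the form $A=\begin{pmatrix} B & 0\\ 0 & C\end{pmatrix}$, where $B$ is a $p\times p$ binary matrix, $C$ is an $(n-p)\times(n-p)$ binary matrix (absent if $p=n$), and all entries of $A$ outside the blocks $B$ and $C$ are $0$, with the following properties: either $p=2$ and $B=\begin{pmatrix}1&1\\1&1\end{pmatrix}$, or $p\ge 3$ and $B=(b_{ij})_{i,j=1}^p$ is the matrix with $b_{11}=b_{pp}=1$, $b_{i,i+1}=b_{i+1,i}=1$ for $1\le i\le p-1$, and all other entries equal to $0$; and either $C$ does not exist, or $C\in\Delta_s^2$ with $s=n-p$ and $2\le s\le n-2$.
   Context: $\Lambda_n^k$ is the set of $n\times n$ matrices with entries in $\{0,1\}$ having exactly $k$ entries equal to $1$ in each row and each column. For a binary $n\times n$ matrix $A=(a_{ij})$ let $x_i=\sum_{j=1}^n a_{ij}2^{n-j}$ (row $i$ read as a binary number) and $y_j=\sum_{i=1}^n a_{ij}2^{n-i}$ (column $j$ read as a binary number). $\mathfrak{D}_{n\times n}$ is the set of binary $n\times n$ matrices with $x_1\ge x_2\ge\cdots\ge x_n$ and $y_1\ge y_2\ge\cdots\ge y_n$, and $\Delta_n^k=\mathfrak{D}_{n\times n}\cap\Lambda_n^k$. -}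

module Defs where

open import Data.Nat using (ℕ; zero; suc; _+_; _*_; _∸_; _^_; _≤_; _≡ᵇ_)
open import Data.Bool using (Bool; true; false; if_then_else_; _∧_; _∨_)
open import Data.Fin using (Fin; toℕ; splitAt) renaming (_≤_ to _≤ᶠ_)
open import Data.Sum using (_⊎_; inj₁; inj₂)
open import Data.Product using (_×_)
open import Relation.Binary.PropositionalEquality using (_≡_)

-- binary n×n matrices; indices are 0-based (row/column i ↔ paper's i+1)
Mat : ℕ → Set
Mat n = Fin n → Fin n → Bool

Σ : ∀ n → (Fin n → ℕ) → ℕ
Σ zero    f = 0
Σ (suc n) f = f Fin.zero + Σ n (λ j → f (Fin.suc j))

bit : Bool → ℕ
bit true  = 1
bit false = 0

-- x_i : row i read as a binary number (column j has weight 2^(n-1-j), 0-based)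
rowVal : ∀ {n} → Mat n → Fin n → ℕ
rowVal {n} A i = Σ n (λ j → bit (A i j) * 2 ^ (n ∸ suc (toℕ j)))

colVal : ∀ {n} → Mat n → Fin n → ℕ
colVal {n} A j = Σ n (λ i → bit (A i j) * 2 ^ (n ∸ suc (toℕ i)))

InLambda : ∀ n → ℕ → Mat n → Set
InLambda n k A = (∀ i → Σ n (λ j → bit (A i j)) ≡ k)
               × (∀ j → Σ n (λ i → bit (A i j)) ≡ k)

InD : ∀ n → Mat n → Set
InD n A = (∀ i j → i ≤ᶠ j → rowVal A j ≤ rowVal A i)
        × (∀ i j → i ≤ᶠ j → colVal A j ≤ colVal A i)

InDelta : ∀ n → ℕ → Mat n → Set
InDelta n k A = InD n A × InLambda n k A

blockDiag : ∀ {p s} → Mat p → Mat s → Mat (p + s)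
blockDiag {p} B C i j with splitAt p i | splitAt p j
... | inj₁ i' | inj₁ j' = B i' j'
... | inj₂ i' | inj₂ j' = C i' j'
... | inj₁ _  | inj₂ _  = false
... | inj₂ _  | inj₁ _  = false

cycleMat : ∀ p → Mat p
cycleMat p i j =
  ((toℕ i ≡ᵇ 0) ∧ (toℕ j ≡ᵇ 0))
  ∨ ((toℕ i ≡ᵇ (p ∸ 1)) ∧ (toℕ j ≡ᵇ (p ∸ 1)))
  ∨ (suc (toℕ i) ≡ᵇ toℕ j)
  ∨ (suc (toℕ j) ≡ᵇ toℕ i)

{-# OPTIONS --safe #-}
-- Read as binary numbers the columns of A decrease, so if two columns agree above row k and
-- the later one has a 1 in row k, then so does the earlier one.  With two 1s per row this
-- forces row 0 to be 1 1 0 … 0, and by symmetry column 0 too.  Inductively, if rows and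
-- columns < t follow the matrix with 1s at (0,0) and on both off-diagonals and A t t = 0,
-- then the 1s of row t sit exactly at t-1 and t+1: a 1 further right would beat column t+1,
-- which is zero above row t.  The first t with A t t = 1 thus closes a block cycleMat (t+1)
-- with zeros beside it, and the lower-right block inherits the orderings and the line sums.
module Submission where

open import Defs
open import Data.Nat using (ℕ; zero; suc; _+_; _*_; _∸_; _^_; _≤_; _<_; _≡ᵇ_; z≤n; s≤s; s≤s⁻¹)
open import Data.Nat.Properties
open import Data.Bool using (Bool; true; false; _∧_; _∨_)
open import Data.Bool.Properties using (∧-comm; ∨-comm; ∧-zeroʳ; ∨-zeroʳ; T-≡; ¬-not)
open import Data.Fin using (Fin; zero; suc; toℕ; fromℕ<; punchIn; punchOut; _↑ˡ_; _↑ʳ_; splitAt; join; cast)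
  renaming (_≤_ to _≤ᶠ_)
open import Data.Fin.Properties
  using (toℕ-injective; toℕ-fromℕ<; toℕ<n; toℕ-↑ˡ; toℕ-↑ʳ; cast-is-id; splitAt-↑ˡ; splitAt-↑ʳ; join-splitAt;
         punchIn-punchOut; punchInᵢ≢i)
open import Data.Product using (Σ-syntax; _×_; _,_; proj₁; proj₂; swap)
open import Data.Sum using (_⊎_; inj₁; inj₂; [_,_]; [_,_]′)
open import Data.Empty using (⊥; ⊥-elim)
open import Function using (_∘_; Equivalence)
open import Relation.Nullary using (contradiction; yes; no)
open import Relation.Binary.Definitions using (tri<; tri≈; tri>)
open import Relation.Binary.PropositionalEquality
open import Algebra.Properties.CommutativeSemigroup +-commutativeSemigroup using (x∙yz≈y∙xz)

Σ-cong : ∀ n {f g : Fin n → ℕ} → (∀ j → f j ≡ g j) → Σ n f ≡ Σ n g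
Σ-cong zero    f≗g = refl
Σ-cong (suc n) f≗g = cong₂ _+_ (f≗g zero) (Σ-cong n (f≗g ∘ suc))

Σ-zero : ∀ n {f : Fin n → ℕ} → (∀ j → f j ≡ 0) → Σ n f ≡ 0
Σ-zero zero    f≗0 = refl
Σ-zero (suc n) f≗0 = cong₂ _+_ (f≗0 zero) (Σ-zero n (f≗0 ∘ suc))

Σ-punchIn : ∀ n (f : Fin (suc n) → ℕ) i → Σ (suc n) f ≡ f i + Σ n (f ∘ punchIn i)
Σ-punchIn n       f zero    = refl
Σ-punchIn (suc n) f (suc i) = begin
  f zero + Σ (suc n) (f ∘ suc)                      ≡⟨ cong (f zero +_) (Σ-punchIn n (f ∘ suc) i) ⟩
  f zero + (f (suc i) + Σ n (f ∘ suc ∘ punchIn i))  ≡⟨ x∙yz≈y∙xz (f zero) (f (suc i)) _ ⟩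
  f (suc i) + (f zero + Σ n (f ∘ suc ∘ punchIn i))  ∎
  where open ≡-Reasoning

Σ-↑ : ∀ p s (f : Fin (p + s) → ℕ) → Σ (p + s) f ≡ Σ p (f ∘ (_↑ˡ s)) + Σ s (f ∘ (p ↑ʳ_))
Σ-↑ zero    s f = refl
Σ-↑ (suc p) s f = trans (cong (f zero +_) (Σ-↑ p s (f ∘ suc))) (sym (+-assoc (f zero) _ _))

count : ∀ {n} → (Fin n → Bool) → ℕ
count {n} u = Σ n (bit ∘ u)

binVal : ∀ {n} → (Fin n → Bool) → ℕ
binVal {n} u = Σ n (λ j → bit (u j) * 2 ^ (n ∸ suc (toℕ j)))

bit≤1 : ∀ b → bit b ≤ 1
bit≤1 true  = ≤-refl
bit≤1 false = z≤n

count≤n : ∀ {n} (u : Fin n → Bool) → count u ≤ n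
count≤n {zero}  u = z≤n
count≤n {suc n} u = +-mono-≤ (bit≤1 (u zero)) (count≤n (u ∘ suc))

count≡0⇒false : ∀ {n} (u : Fin n → Bool) → count u ≡ 0 → ∀ j → u j ≡ false
count≡0⇒false u eq zero    with u zero | eq
... | false | _ = refl
count≡0⇒false u eq (suc j) with u zero | eq
... | false | eq′ = count≡0⇒false (u ∘ suc) eq′ j

count≡suc⇒true : ∀ {n k} (u : Fin n → Bool) → count u ≡ suc k → Σ[ j ∈ Fin n ] u j ≡ true
count≡suc⇒true {suc n} u eq with u zero in u₀ | eq
... | true  | _   = zero , u₀
... | false | eq′ with count≡suc⇒true (u ∘ suc) eq′
...   | j , uj = suc j , uj

count-punchIn : ∀ {n k} (u : Fin (suc n) → Bool) a → u a ≡ true → count u ≡ suc k → count (u ∘ punchIn a) ≡ k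
count-punchIn {n} {k} u a ua eq = suc-injective (begin
  suc (count (u ∘ punchIn a))        ≡⟨ cong (λ b → bit b + count (u ∘ punchIn a)) (sym ua) ⟩
  bit (u a) + count (u ∘ punchIn a)  ≡⟨ sym (Σ-punchIn n (bit ∘ u) a) ⟩
  count u                            ≡⟨ eq ⟩
  suc k                              ∎)
  where open ≡-Reasoning

count≡1⇒false : ∀ {n} (u : Fin n → Bool) {a c} → count u ≡ 1 → u a ≡ true → c ≢ a → u c ≡ false
count≡1⇒false {suc n} u {a} {c} eq ua c≢a = begin
  u c                          ≡⟨ cong u (punchIn-punchOut a≢c) ⟨
  u (punchIn a (punchOut a≢c)) ≡⟨ count≡0⇒false (u ∘ punchIn a) (count-punchIn u a ua eq) _ ⟩
  false                        ∎
  where open ≡-Reasoning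
        a≢c = c≢a ∘ sym

count≡2⇒other : ∀ {n} (u : Fin n → Bool) {a} → count u ≡ 2 → u a ≡ true → Σ[ b ∈ Fin n ] b ≢ a × u b ≡ true
count≡2⇒other {suc n} u {a} eq ua with count≡suc⇒true (u ∘ punchIn a) (count-punchIn u a ua eq)
... | j , uj = punchIn a j , punchInᵢ≢i a j , uj

count≡2⇒false : ∀ {n} (u : Fin n → Bool) {a b c} → count u ≡ 2 → u a ≡ true → u b ≡ true → b ≢ a →
                c ≢ a → c ≢ b → u c ≡ false
count≡2⇒false {suc n} u {a} {b} {c} eq ua ub b≢a c≢a c≢b = begin
  u c                          ≡⟨ cong u (punchIn-punchOut a≢c) ⟨
  u (punchIn a (punchOut a≢c)) ≡⟨ count≡1⇒false (u ∘ punchIn a) (count-punchIn u a ua eq) ub′ c′≢b′ ⟩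
  false                        ∎
  where
  open ≡-Reasoning
  a≢c = c≢a ∘ sym
  a≢b = b≢a ∘ sym
  ub′ : u (punchIn a (punchOut a≢b)) ≡ true
  ub′ = trans (cong u (punchIn-punchOut a≢b)) ub
  c′≢b′ : punchOut a≢c ≢ punchOut a≢b
  c′≢b′ eq′ = c≢b (begin
    c                            ≡⟨ punchIn-punchOut a≢c ⟨
    punchIn a (punchOut a≢c)     ≡⟨ cong (punchIn a) eq′ ⟩
    punchIn a (punchOut a≢b)     ≡⟨ punchIn-punchOut a≢b ⟩
    b                            ∎)

binVal<2^n : ∀ {n} (u : Fin n → Bool) → binVal u < 2 ^ n
binVal<2^n {zero}  u = s≤s z≤n
binVal<2^n {suc n} u = begin-strict
  bit (u zero) * 2 ^ n + binVal (u ∘ suc)  <⟨ +-monoʳ-< _ (binVal<2^n (u ∘ suc)) ⟩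
  bit (u zero) * 2 ^ n + 2 ^ n             ≤⟨ +-monoˡ-≤ (2 ^ n) (*-monoˡ-≤ (2 ^ n) (bit≤1 (u zero))) ⟩
  1 * 2 ^ n + 2 ^ n                        ≡⟨ cong (_+ 2 ^ n) (*-identityˡ (2 ^ n)) ⟩
  2 ^ n + 2 ^ n                            ≡⟨ cong (2 ^ n +_) (+-identityʳ (2 ^ n)) ⟨
  2 * 2 ^ n                                ∎
  where open ≤-Reasoning

binVal-lex : ∀ {n} (u v : Fin n → Bool) k → (∀ k′ → toℕ k′ < toℕ k → u k′ ≡ v k′) →
             u k ≡ false → v k ≡ true → binVal u < binVal v
binVal-lex {suc n} u v zero _ uk vk rewrite uk | vk = begin-strict
  binVal (u ∘ suc)              <⟨ binVal<2^n (u ∘ suc) ⟩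
  2 ^ n                         ≤⟨ m≤m+n (2 ^ n) _ ⟩
  2 ^ n + binVal (v ∘ suc)      ≡⟨ cong (_+ binVal (v ∘ suc)) (*-identityˡ (2 ^ n)) ⟨
  1 * 2 ^ n + binVal (v ∘ suc)  ∎
  where open ≤-Reasoning
binVal-lex {suc n} u v (suc k) agree uk vk rewrite agree zero (s≤s z≤n) =
  +-monoʳ-< _ (binVal-lex (u ∘ suc) (v ∘ suc) k (λ k′ → agree (suc k′) ∘ s≤s) uk vk)

transpose : ∀ {n} → Mat n → Mat n
transpose A i j = A j i

InDelta-transpose : ∀ {n k} (A : Mat n) → InDelta n k A → InDelta n k (transpose A)
InDelta-transpose A ((rowsDesc , colsDesc) , (rowSums , colSums)) = (colsDesc , rowsDesc) , (colSums , rowSums)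

InLambda-empty⊎k≤n : ∀ {s k} {C : Mat s} → InLambda s k C → s ≡ 0 ⊎ k ≤ s
InLambda-empty⊎k≤n {zero}          _             = inj₁ refl
InLambda-empty⊎k≤n {suc s} {C = C} (rowSums , _) = inj₂ (subst (_≤ suc s) (rowSums zero) (count≤n (C zero)))

InD-earlierColumn : ∀ {n} (A : Mat n) → InD n A → ∀ {i j} k → toℕ i ≤ toℕ j →
                    (∀ k′ → toℕ k′ < toℕ k → A k′ i ≡ A k′ j) → A k j ≡ true → A k i ≡ true
InD-earlierColumn A (_ , colsDesc) {i} {j} k i≤j agree Akj with A k i in Aki
... | true  = refl
... | false = contradiction (colsDesc i j i≤j) (<⇒≱ (binVal-lex (λ r → A r i) (λ r → A r j) k agree Aki Akj))

↑-induction : ∀ {p s} (P : Fin (p + s) → Set) → (∀ x → P (x ↑ˡ s)) → (∀ y → P (p ↑ʳ y)) → ∀ i → P i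
↑-induction {p} {s} P left right i = subst P (join-splitAt p s i) ([_,_] {C = P ∘ join p s} left right (splitAt p i))

≡blockDiag : ∀ {p s} {A : Mat (p + s)} {B : Mat p} {C : Mat s} →
             (∀ x y → A (x ↑ˡ s) (y ↑ˡ s) ≡ B x y) → (∀ x y → A (x ↑ˡ s) (p ↑ʳ y) ≡ false) →
             (∀ x y → A (p ↑ʳ x) (y ↑ˡ s) ≡ false) → (∀ x y → A (p ↑ʳ x) (p ↑ʳ y) ≡ C x y) →
             ∀ i j → A i j ≡ blockDiag B C i j
≡blockDiag {p} {s} {A} {B} {C} A≡B upperRight0 lowerLeft0 A≡C =
  ↑-induction _ (λ x → ↑-induction _ (upper x) (upperOff x)) (λ x → ↑-induction _ (lowerOff x) (lower x))
  where
  upper : ∀ x y → A (x ↑ˡ s) (y ↑ˡ s) ≡ blockDiag B C (x ↑ˡ s) (y ↑ˡ s)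
  upper x y rewrite splitAt-↑ˡ p x s | splitAt-↑ˡ p y s = A≡B x y
  upperOff : ∀ x y → A (x ↑ˡ s) (p ↑ʳ y) ≡ blockDiag B C (x ↑ˡ s) (p ↑ʳ y)
  upperOff x y rewrite splitAt-↑ˡ p x s | splitAt-↑ʳ p s y = upperRight0 x y
  lowerOff : ∀ x y → A (p ↑ʳ x) (y ↑ˡ s) ≡ blockDiag B C (p ↑ʳ x) (y ↑ˡ s)
  lowerOff x y rewrite splitAt-↑ʳ p s x | splitAt-↑ˡ p y s = lowerLeft0 x y
  lower : ∀ x y → A (p ↑ʳ x) (p ↑ʳ y) ≡ blockDiag B C (p ↑ʳ x) (p ↑ʳ y)
  lower x y rewrite splitAt-↑ʳ p s x | splitAt-↑ʳ p s y = A≡C x y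

count-dropLeft : ∀ p {s} (u : Fin (p + s) → Bool) → (∀ x → u (x ↑ˡ s) ≡ false) → count u ≡ count (u ∘ (p ↑ʳ_))
count-dropLeft p {s} u left0 = trans (Σ-↑ p s (bit ∘ u)) (cong (_+ count (u ∘ (p ↑ʳ_))) (Σ-zero p (cong bit ∘ left0)))

binVal-dropLeft : ∀ p {s} (u : Fin (p + s) → Bool) → (∀ x → u (x ↑ˡ s) ≡ false) → binVal u ≡ binVal (u ∘ (p ↑ʳ_))
binVal-dropLeft p {s} u left0 = begin
  binVal u
    ≡⟨ Σ-↑ p s _ ⟩
  Σ p (λ x → bit (u (x ↑ˡ s)) * 2 ^ (p + s ∸ suc (toℕ (x ↑ˡ s)))) + Σ s (λ y → bit (u (p ↑ʳ y)) * 2 ^ (p + s ∸ suc (toℕ (p ↑ʳ y))))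
    ≡⟨ cong₂ _+_ (Σ-zero p (λ x → cong (λ b → bit b * _) (left0 x))) (Σ-cong s (λ y → cong (λ e → bit (u (p ↑ʳ y)) * 2 ^ e) (exponent y))) ⟩
  binVal (u ∘ (p ↑ʳ_))
    ∎
  where
  open ≡-Reasoning
  exponent : ∀ y → p + s ∸ suc (toℕ (p ↑ʳ y)) ≡ s ∸ suc (toℕ y)
  exponent y = begin
    p + s ∸ suc (toℕ (p ↑ʳ y))  ≡⟨ cong (λ e → p + s ∸ suc e) (toℕ-↑ʳ p y) ⟩
    p + s ∸ suc (p + toℕ y)     ≡⟨ cong (p + s ∸_) (+-suc p (toℕ y)) ⟨
    p + s ∸ (p + suc (toℕ y))   ≡⟨ [m+n]∸[m+o]≡n∸o p s (suc (toℕ y)) ⟩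
    s ∸ suc (toℕ y)             ∎

lowerRight : ∀ p {s} → Mat (p + s) → Mat s
lowerRight p A x y = A (p ↑ʳ x) (p ↑ʳ y)

module _ p {s} {A : Mat (p + s)} (lowerLeft0 : ∀ x y → A (p ↑ʳ x) (y ↑ˡ s) ≡ false) where

  lowerRight-rowsDesc : (∀ i j → i ≤ᶠ j → rowVal A j ≤ rowVal A i) →
                        ∀ x y → x ≤ᶠ y → rowVal (lowerRight p A) y ≤ rowVal (lowerRight p A) x
  lowerRight-rowsDesc rowsDesc x y x≤y =
    subst₂ _≤_ (rowVal-dropLeft y) (rowVal-dropLeft x) (rowsDesc (p ↑ʳ x) (p ↑ʳ y) ↑x≤↑y)
    where
    rowVal-dropLeft : ∀ x → rowVal A (p ↑ʳ x) ≡ rowVal (lowerRight p A) x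
    rowVal-dropLeft x = binVal-dropLeft p (A (p ↑ʳ x)) (lowerLeft0 x)
    ↑x≤↑y : toℕ (p ↑ʳ x) ≤ toℕ (p ↑ʳ y)
    ↑x≤↑y rewrite toℕ-↑ʳ p x | toℕ-↑ʳ p y = +-monoʳ-≤ p x≤y

  lowerRight-rowSums : ∀ {k} → (∀ i → count (A i) ≡ k) → ∀ x → count (lowerRight p A x) ≡ k
  lowerRight-rowSums rowSums x = trans (sym (count-dropLeft p (A (p ↑ʳ x)) (lowerLeft0 x))) (rowSums (p ↑ʳ x))

InDelta-lowerRight : ∀ p {s k} (A : Mat (p + s)) → InDelta (p + s) k A →
                     (∀ x y → A (x ↑ˡ s) (p ↑ʳ y) ≡ false) → (∀ x y → A (p ↑ʳ x) (y ↑ˡ s) ≡ false) →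
                     InDelta s k (lowerRight p A)
InDelta-lowerRight p A ((rowsDesc , colsDesc) , (rowSums , colSums)) upperRight0 lowerLeft0 =
    (lowerRight-rowsDesc p {A = A} lowerLeft0 rowsDesc , lowerRight-rowsDesc p {A = transpose A} upperRight0ᵀ colsDesc)
  , (lowerRight-rowSums p {A = A} lowerLeft0 rowSums , lowerRight-rowSums p {A = transpose A} upperRight0ᵀ colSums)
  where
  upperRight0ᵀ : ∀ x y → A (y ↑ˡ _) (p ↑ʳ x) ≡ false
  upperRight0ᵀ x y = upperRight0 y x

≡ᵇ-refl : ∀ m → (m ≡ᵇ m) ≡ true
≡ᵇ-refl m = Equivalence.to T-≡ (≡⇒≡ᵇ m m refl)

≢⇒≡ᵇ≡false : ∀ {m n} → m ≢ n → (m ≡ᵇ n) ≡ false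
≢⇒≡ᵇ≡false {m} {n} m≢n = ¬-not (m≢n ∘ ≡ᵇ⇒≡ m n ∘ Equivalence.from T-≡)

-- cycleMat p i j unfolds to cycleEntry p (toℕ i) (toℕ j); pathEntry is the same pattern without
-- the corner (p-1, p-1), i.e. the infinite matrix with 1s at (0,0) and on both off-diagonals.
pathEntry : ℕ → ℕ → Bool
pathEntry a b = ((a ≡ᵇ 0) ∧ (b ≡ᵇ 0)) ∨ (suc a ≡ᵇ b) ∨ (suc b ≡ᵇ a)

cycleEntry : ℕ → ℕ → ℕ → Bool
cycleEntry p a b = ((a ≡ᵇ 0) ∧ (b ≡ᵇ 0)) ∨ ((a ≡ᵇ (p ∸ 1)) ∧ (b ≡ᵇ (p ∸ 1))) ∨ (suc a ≡ᵇ b) ∨ (suc b ≡ᵇ a)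

pathEntry-sym : ∀ a b → pathEntry a b ≡ pathEntry b a
pathEntry-sym a b = cong₂ _∨_ (∧-comm (a ≡ᵇ 0) (b ≡ᵇ 0)) (∨-comm (suc a ≡ᵇ b) (suc b ≡ᵇ a))

pathEntry-suc : ∀ a → pathEntry a (suc a) ≡ true
pathEntry-suc a rewrite ≡ᵇ-refl a = ∨-zeroʳ _

pathEntry-pred : ∀ a → pathEntry (suc a) a ≡ true
pathEntry-pred a = trans (pathEntry-sym (suc a) a) (pathEntry-suc a)

pathEntry-far : ∀ {a b} → suc a < b → pathEntry a b ≡ false
pathEntry-far {b = suc zero} (s≤s ())
pathEntry-far {a} {suc (suc b)} a+1<b+2
  rewrite ∧-zeroʳ (a ≡ᵇ 0)
        | ≢⇒≡ᵇ≡false (<⇒≢ a+1<b+2)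
        | ≢⇒≡ᵇ≡false (>⇒≢ (<-trans (n<1+n a) (m<n⇒m<1+n a+1<b+2)))
  = refl

pathEntry-suc-other : ∀ {a b} → b ≢ a → b ≢ suc (suc a) → pathEntry (suc a) b ≡ false
pathEntry-suc-other b≢a b≢a+2 rewrite ≢⇒≡ᵇ≡false (b≢a+2 ∘ sym) | ≢⇒≡ᵇ≡false b≢a = refl

cycleEntry-offCornerˡ : ∀ p a b → a ≢ p ∸ 1 → cycleEntry p a b ≡ pathEntry a b
cycleEntry-offCornerˡ p a b a≢p-1 rewrite ≢⇒≡ᵇ≡false a≢p-1 = refl

cycleEntry-offCornerʳ : ∀ p a b → b ≢ p ∸ 1 → cycleEntry p a b ≡ pathEntry a b
cycleEntry-offCornerʳ p a b b≢p-1 rewrite ≢⇒≡ᵇ≡false b≢p-1 | ∧-zeroʳ (a ≡ᵇ (p ∸ 1)) = refl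

cycleEntry-corner : ∀ p → cycleEntry p (p ∸ 1) (p ∸ 1) ≡ true
cycleEntry-corner p rewrite ≡ᵇ-refl (p ∸ 1) = ∨-zeroʳ _

cycleMat-shape : ∀ t → (2 + t ≡ 2 × (∀ i j → cycleMat (2 + t) i j ≡ true))
                     ⊎ (3 ≤ 2 + t × (∀ i j → cycleMat (2 + t) i j ≡ cycleMat (2 + t) i j))
cycleMat-shape zero    = inj₁ (refl , λ { zero zero → refl ; zero (suc zero) → refl ; (suc zero) zero → refl ; (suc zero) (suc zero) → refl })
cycleMat-shape (suc t) = inj₂ (s≤s (s≤s (s≤s z≤n)) , λ _ _ → refl)

true≢false : true ≢ false
true≢false ()

toℕ≢⇒≢ : ∀ {n} {i j : Fin n} {a} → toℕ j ≡ a → toℕ i ≢ a → i ≢ j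
toℕ≢⇒≢ j≡a i≢a refl = i≢a j≡a

RowsFollowPath : ∀ {n} → Mat n → ℕ → Set
RowsFollowPath A t = ∀ i j → toℕ i < t → A i j ≡ pathEntry (toℕ i) (toℕ j)

PathPrefix : ∀ {n} → Mat n → ℕ → Set
PathPrefix A t = RowsFollowPath A t × RowsFollowPath (transpose A) t

RowsFollowPath-extend : ∀ {n} {A : Mat n} {t} (r : Fin n) → toℕ r ≡ t → RowsFollowPath A t →
                        (∀ j → A r j ≡ pathEntry t (toℕ j)) → RowsFollowPath A (suc t)
RowsFollowPath-extend r r≡t rows rowR i j i<t+1 with m<1+n⇒m<n∨m≡n i<t+1
... | inj₁ i<t = rows i j i<t
... | inj₂ i≡t with toℕ-injective (trans i≡t (sym r≡t))
...   | refl = trans (rowR j) (cong (λ a → pathEntry a (toℕ j)) (sym r≡t))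

firstRow : ∀ {m} (A : Mat (2 + m)) → InDelta (2 + m) 2 A → ∀ j → A zero j ≡ pathEntry 0 (toℕ j)
firstRow A (D , rowSums , _) = row
  where
  A00 : A zero zero ≡ true
  A00 = InD-earlierColumn A D zero z≤n (λ _ ()) (proj₂ (count≡suc⇒true (A zero) (rowSums zero)))
  A01 : A zero (suc zero) ≡ true
  A01 with count≡2⇒other (A zero) (rowSums zero) A00
  ... | zero  , c≢0 , _   = contradiction refl c≢0
  ... | suc c , _   , A0c = InD-earlierColumn A D zero (s≤s z≤n) (λ _ ()) A0c
  row : ∀ j → A zero j ≡ pathEntry 0 (toℕ j)
  row zero          = A00
  row (suc zero)    = A01
  row (suc (suc j)) = count≡2⇒false (A zero) (rowSums zero) A00 A01 (λ ()) (λ ()) (λ ())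

PathPrefix-1 : ∀ {m} (A : Mat (2 + m)) → InDelta (2 + m) 2 A → PathPrefix A 1
PathPrefix-1 A Δ = firstRows A Δ , firstRows (transpose A) (InDelta-transpose A Δ)
  where
  firstRows : ∀ {m} (A : Mat (2 + m)) → InDelta (2 + m) 2 A → RowsFollowPath A 1
  firstRows A Δ zero    j _        = firstRow A Δ j
  firstRows A Δ (suc i) j (s≤s ())

module _ {n} {A : Mat n} (Δ : InDelta n 2 A) {t} (r : Fin n) (r≡t+1 : toℕ r ≡ suc t)
         (prefix : PathPrefix A (suc t)) where

  private
    rows : RowsFollowPath A (suc t)
    rows = proj₁ prefix

    cols : RowsFollowPath (transpose A) (suc t)
    cols = proj₂ prefix

    rowSum : count (A r) ≡ 2
    rowSum = proj₁ (proj₂ Δ) r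

    t<n : t < n
    t<n = <-trans (n<1+n t) (subst (_< n) r≡t+1 (toℕ<n r))

    prev : Fin n
    prev = fromℕ< t<n

    prev≡t : toℕ prev ≡ t
    prev≡t = toℕ-fromℕ< t<n

    Arprev : A r prev ≡ true
    Arprev = begin
      A r prev                            ≡⟨ cols prev r (s≤s (≤-reflexive prev≡t)) ⟩
      pathEntry (toℕ prev) (toℕ r)        ≡⟨ cong₂ pathEntry prev≡t r≡t+1 ⟩
      pathEntry t (suc t)                 ≡⟨ pathEntry-suc t ⟩
      true                                ∎
      where open ≡-Reasoning

    zeroBeyond : ∀ k j → toℕ k < suc t → suc (suc t) ≤ toℕ j → A k j ≡ false
    zeroBeyond k j k<t+1 t+2≤j = trans (rows k j k<t+1) (pathEntry-far (≤-trans (s≤s k<t+1) t+2≤j))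

  pathRow : A r r ≡ false → Σ[ c ∈ Fin n ] toℕ c ≡ suc (suc t) × (∀ j → A r j ≡ pathEntry (suc t) (toℕ j))
  pathRow Arr≡false = c , c≡t+2 , rowR
    where
    c : Fin n
    c = proj₁ (count≡2⇒other (A r) rowSum Arprev)
    c≢prev : c ≢ prev
    c≢prev = proj₁ (proj₂ (count≡2⇒other (A r) rowSum Arprev))
    Arc : A r c ≡ true
    Arc = proj₂ (proj₂ (count≡2⇒other (A r) rowSum Arprev))

    noJump : suc (suc t) < toℕ c → ⊥
    noJump t+2<c = true≢false (trans (sym Arm) (count≡2⇒false (A r) rowSum Arprev Arc c≢prev (toℕ≢⇒≢ prev≡t m≢t) m≢c))
      where
      t+2<n = <-trans t+2<c (toℕ<n c)
      m = fromℕ< t+2<n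
      m≡t+2 : toℕ m ≡ suc (suc t)
      m≡t+2 = toℕ-fromℕ< t+2<n
      m≢t : toℕ m ≢ t
      m≢t m≡t = <-irrefl (trans (sym m≡t) m≡t+2) (<-trans (n<1+n t) (n<1+n (suc t)))
      m≢c : m ≢ c
      m≢c m≡c = <-irrefl (trans (sym m≡t+2) (cong toℕ m≡c)) t+2<c
      agreeAbove : ∀ k → toℕ k < toℕ r → A k m ≡ A k c
      agreeAbove k k<r = trans (zeroBeyond k m k<t+1 (≤-reflexive (sym m≡t+2))) (sym (zeroBeyond k c k<t+1 (<⇒≤ t+2<c)))
        where k<t+1 = subst (toℕ k <_) r≡t+1 k<r
      Arm : A r m ≡ true
      Arm = InD-earlierColumn A (proj₁ Δ) r (≤-trans (≤-reflexive m≡t+2) (<⇒≤ t+2<c)) agreeAbove Arc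

    c≡t+2 : toℕ c ≡ suc (suc t)
    c≡t+2 with <-cmp (toℕ c) (suc (suc t))
    ... | tri≈ _ c≡t+2 _  = c≡t+2
    ... | tri> _ _ t+2<c  = ⊥-elim (noJump t+2<c)
    ... | tri< c<t+2 _ _ with <-cmp (toℕ c) t
    ...   | tri< c<t _ _  = ⊥-elim (true≢false (begin
              true                         ≡⟨ Arc ⟨
              A r c                        ≡⟨ cols c r (<-trans c<t (n<1+n t)) ⟩
              pathEntry (toℕ c) (toℕ r)    ≡⟨ cong (pathEntry (toℕ c)) r≡t+1 ⟩
              pathEntry (toℕ c) (suc t)    ≡⟨ pathEntry-far (s≤s c<t) ⟩
              false                        ∎))
      where open ≡-Reasoning
    ...   | tri≈ _ c≡t _  = ⊥-elim (c≢prev (toℕ-injective (trans c≡t (sym prev≡t))))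
    ...   | tri> _ _ t<c  = ⊥-elim (true≢false (trans (sym Arc) (trans (cong (A r) c≡r) Arr≡false)))
      where c≡r = toℕ-injective (trans (≤-antisym (s≤s⁻¹ c<t+2) t<c) (sym r≡t+1))

    rowR : ∀ j → A r j ≡ pathEntry (suc t) (toℕ j)
    rowR j with toℕ j ≟ t | toℕ j ≟ suc (suc t)
    ... | yes j≡t | _ = begin
      A r j                        ≡⟨ cong (A r) (toℕ-injective (trans j≡t (sym prev≡t))) ⟩
      A r prev                     ≡⟨ Arprev ⟩
      true                         ≡⟨ pathEntry-pred t ⟨
      pathEntry (suc t) t          ≡⟨ cong (pathEntry (suc t)) j≡t ⟨
      pathEntry (suc t) (toℕ j)    ∎
      where open ≡-Reasoning
    ... | no _ | yes j≡t+2 = begin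
      A r j                           ≡⟨ cong (A r) (toℕ-injective (trans j≡t+2 (sym c≡t+2))) ⟩
      A r c                           ≡⟨ Arc ⟩
      true                            ≡⟨ pathEntry-suc (suc t) ⟨
      pathEntry (suc t) (suc (suc t)) ≡⟨ cong (pathEntry (suc t)) j≡t+2 ⟨
      pathEntry (suc t) (toℕ j)       ∎
      where open ≡-Reasoning
    ... | no j≢t | no j≢t+2 =
      trans (count≡2⇒false (A r) rowSum Arprev Arc c≢prev (toℕ≢⇒≢ prev≡t j≢t) (toℕ≢⇒≢ c≡t+2 j≢t+2))
            (sym (pathEntry-suc-other j≢t j≢t+2))

  cycleBlock : A r r ≡ true → ∀ i j → toℕ i < 2 + t → toℕ j < 2 + t → A i j ≡ cycleEntry (2 + t) (toℕ i) (toℕ j)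
  cycleBlock Arr i j i<t+2 j<t+2 with m<1+n⇒m<n∨m≡n i<t+2 | m<1+n⇒m<n∨m≡n j<t+2
  ... | inj₁ i<t+1 | _ = trans (rows i j i<t+1) (sym (cycleEntry-offCornerˡ (2 + t) (toℕ i) (toℕ j) (<⇒≢ i<t+1)))
  ... | inj₂ _ | inj₁ j<t+1 = begin
    A i j                               ≡⟨ cols j i j<t+1 ⟩
    pathEntry (toℕ j) (toℕ i)           ≡⟨ pathEntry-sym (toℕ j) (toℕ i) ⟩
    pathEntry (toℕ i) (toℕ j)           ≡⟨ cycleEntry-offCornerʳ (2 + t) (toℕ i) (toℕ j) (<⇒≢ j<t+1) ⟨
    cycleEntry (2 + t) (toℕ i) (toℕ j)  ∎
    where open ≡-Reasoning
  ... | inj₂ i≡t+1 | inj₂ j≡t+1 with toℕ-injective (trans i≡t+1 (sym r≡t+1)) | toℕ-injective (trans j≡t+1 (sym r≡t+1))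
  ...   | refl | refl = trans Arr (sym (trans (cong₂ (cycleEntry (2 + t)) r≡t+1 r≡t+1) (cycleEntry-corner (2 + t))))

  cycleRows-zeroBeyond : A r r ≡ true → ∀ i j → toℕ i < 2 + t → 2 + t ≤ toℕ j → A i j ≡ false
  cycleRows-zeroBeyond Arr i j i<t+2 t+2≤j with m<1+n⇒m<n∨m≡n i<t+2
  ... | inj₁ i<t+1 = zeroBeyond i j i<t+1 t+2≤j
  ... | inj₂ i≡t+1 with toℕ-injective (trans i≡t+1 (sym r≡t+1))
  ...   | refl = count≡2⇒false (A r) rowSum Arprev Arr (toℕ≢⇒≢ prev≡t r≢t) (toℕ≢⇒≢ prev≡t j≢t) (toℕ≢⇒≢ r≡t+1 j≢t+1)
    where
    r≢t : toℕ r ≢ t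
    r≢t r≡t = <-irrefl (trans (sym r≡t) r≡t+1) (n<1+n t)
    j≢t : toℕ j ≢ t
    j≢t j≡t = <-irrefl (sym j≡t) (≤-trans (n≤1+n _) t+2≤j)
    j≢t+1 : toℕ j ≢ suc t
    j≢t+1 j≡t+1 = <-irrefl (sym j≡t+1) t+2≤j

PathPrefix-step : ∀ {n} (A : Mat n) → InDelta n 2 A → ∀ {t} (r : Fin n) → toℕ r ≡ suc t → PathPrefix A (suc t) →
                  A r r ≡ false → Σ[ c ∈ Fin n ] toℕ c ≡ suc (suc t) × PathPrefix A (suc (suc t))
PathPrefix-step A Δ r r≡t+1 prefix Arr
  with pathRow Δ r r≡t+1 prefix Arr | pathRow (InDelta-transpose A Δ) r r≡t+1 (swap prefix) Arr
... | c , c≡t+2 , rowR | _ , _ , colR =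
  c , c≡t+2 , RowsFollowPath-extend r r≡t+1 (proj₁ prefix) rowR , RowsFollowPath-extend r r≡t+1 (proj₂ prefix) colR

-- k is fuel: each step moves r one row down, and r stays below n.
pathUntilDiagonalOne : ∀ {n} (A : Mat n) → InDelta n 2 A → ∀ k (r : Fin n) {t} → toℕ r ≡ suc t → n ≤ k + toℕ r →
                       PathPrefix A (suc t) → Σ[ r ∈ Fin n ] Σ[ t ∈ ℕ ] toℕ r ≡ suc t × PathPrefix A (suc t) × A r r ≡ true
pathUntilDiagonalOne {n} A Δ zero r _ n≤r _ = contradiction (toℕ<n r) (≤⇒≯ n≤r)
pathUntilDiagonalOne {n} A Δ (suc k) r {t} r≡t+1 n≤k+1+r prefix with A r r in Arr
... | true  = r , t , r≡t+1 , prefix , Arr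
... | false with PathPrefix-step A Δ r r≡t+1 prefix Arr
...   | c , c≡t+2 , prefix′ = pathUntilDiagonalOne A Δ k c c≡t+2 n≤k+c prefix′
  where
  n≤k+c : n ≤ k + toℕ c
  n≤k+c = subst (n ≤_) (begin
    suc k + toℕ r    ≡⟨ +-suc k (toℕ r) ⟨
    k + suc (toℕ r)  ≡⟨ cong (λ a → k + suc a) r≡t+1 ⟩
    k + suc (suc t)  ≡⟨ cong (k +_) c≡t+2 ⟨
    k + toℕ c        ∎) n≤k+1+r
    where open ≡-Reasoning

LeadingCycleBlock : ∀ {n} → Mat n → ℕ → Set
LeadingCycleBlock A p = (∀ i j → toℕ i < p → toℕ j < p → A i j ≡ cycleEntry p (toℕ i) (toℕ j))
                      × (∀ i j → toℕ i < p → p ≤ toℕ j → A i j ≡ false)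
                      × (∀ i j → p ≤ toℕ i → toℕ j < p → A i j ≡ false)

leadingCycleBlock : ∀ {n} (A : Mat n) → InDelta n 2 A → 2 ≤ n → Σ[ t ∈ ℕ ] 2 + t ≤ n × LeadingCycleBlock A (2 + t)
leadingCycleBlock {n} A Δ (s≤s (s≤s _))
  with pathUntilDiagonalOne A Δ n (suc zero) refl (m≤m+n n 1) (PathPrefix-1 A Δ)
... | r , t , r≡t+1 , prefix , Arr =
  t , subst (_< n) r≡t+1 (toℕ<n r) ,
  cycleBlock Δ r r≡t+1 prefix Arr ,
  cycleRows-zeroBeyond Δ r r≡t+1 prefix Arr ,
  λ i j t+2≤i j<t+2 → cycleRows-zeroBeyond (InDelta-transpose A Δ) r r≡t+1 (swap prefix) Arr j i j<t+2 t+2≤i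

BlockDiagonalForm : (n : ℕ) → Mat n → Set
BlockDiagonalForm n A =
  Σ[ p ∈ ℕ ] Σ[ s ∈ ℕ ] Σ[ B ∈ Mat p ] Σ[ C ∈ Mat s ] Σ[ eq ∈ p + s ≡ n ]
      (2 ≤ p × p ≤ n)
      × (∀ (i j : Fin n) → A i j ≡ blockDiag B C (cast (sym eq) i) (cast (sym eq) j))
      × ((p ≡ 2 × (∀ i j → B i j ≡ true)) ⊎ (3 ≤ p × (∀ i j → B i j ≡ cycleMat p i j)))
      × (s ≡ 0 ⊎ (2 ≤ s × s ≤ n ∸ 2 × InDelta s 2 C))

toℕ↑ˡ< : ∀ {p} s (x : Fin p) → toℕ (x ↑ˡ s) < p
toℕ↑ˡ< s x = subst (_< _) (sym (toℕ-↑ˡ x s)) (toℕ<n x)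

≤toℕ↑ʳ : ∀ p {s} (y : Fin s) → p ≤ toℕ (p ↑ʳ y)
≤toℕ↑ʳ p y = subst (p ≤_) (sym (toℕ-↑ʳ p y)) (m≤m+n p (toℕ y))

blockDiagonalForm : ∀ t s n → 2 + t + s ≡ n → (A : Mat n) → InDelta n 2 A → LeadingCycleBlock A (2 + t) →
                    BlockDiagonalForm n A
blockDiagonalForm t s _ refl A Δ (block , upperRight0 , lowerLeft0) =
  p , s , cycleMat p , lowerRight p A , refl , (s≤s (s≤s z≤n) , m≤m+n p s) ,
  A≡blockDiag , cycleMat-shape t , [ inj₁ , (λ 2≤s → inj₂ (2≤s , m≤n+m s t , C∈Δ)) ]′ (InLambda-empty⊎k≤n (proj₂ C∈Δ))
  where
  p = 2 + t
  A≡cycle : ∀ x y → A (x ↑ˡ s) (y ↑ˡ s) ≡ cycleMat p x y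
  A≡cycle x y = trans (block _ _ (toℕ↑ˡ< s x) (toℕ↑ˡ< s y)) (cong₂ (cycleEntry p) (toℕ-↑ˡ x s) (toℕ-↑ˡ y s))
  upperRight0′ : ∀ x y → A (x ↑ˡ s) (p ↑ʳ y) ≡ false
  upperRight0′ x y = upperRight0 _ _ (toℕ↑ˡ< s x) (≤toℕ↑ʳ p y)
  lowerLeft0′ : ∀ x y → A (p ↑ʳ x) (y ↑ˡ s) ≡ false
  lowerLeft0′ x y = lowerLeft0 _ _ (≤toℕ↑ʳ p x) (toℕ↑ˡ< s y)
  C∈Δ : InDelta s 2 (lowerRight p A)
  C∈Δ = InDelta-lowerRight p A Δ upperRight0′ lowerLeft0′
  A≡blockDiag : ∀ i j → A i j ≡ blockDiag (cycleMat p) (lowerRight p A) (cast refl i) (cast refl j)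
  A≡blockDiag i j rewrite cast-is-id refl i | cast-is-id refl j =
    ≡blockDiag A≡cycle upperRight0′ lowerLeft0′ (λ _ _ → refl) i j

theorem2 : (n : ℕ) → 2 ≤ n → (A : Mat n) → InDelta n 2 A →
    Σ[ p ∈ ℕ ] Σ[ s ∈ ℕ ] Σ[ B ∈ Mat p ] Σ[ C ∈ Mat s ] Σ[ eq ∈ p + s ≡ n ]
      (2 ≤ p × p ≤ n)
      × (∀ (i j : Fin n) → A i j ≡ blockDiag B C (cast (sym eq) i) (cast (sym eq) j))
      × ((p ≡ 2 × (∀ i j → B i j ≡ true)) ⊎ (3 ≤ p × (∀ i j → B i j ≡ cycleMat p i j)))
      × (s ≡ 0 ⊎ (2 ≤ s × s ≤ n ∸ 2 × InDelta s 2 C))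
theorem2 n 2≤n A Δ with leadingCycleBlock A Δ 2≤n
... | t , p≤n , block = blockDiagonalForm t (n ∸ (2 + t)) n (m+[n∸m]≡n p≤n) A Δ block
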